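{- Let $\mathcal{K}=(E,\mathcal{I},c,p,\beta)$ be a BMI instance and $0<\varepsilon<\frac12$, and let $R\subseteq E$ be a representative set of $\mathcal{K}$ and $\varepsilon$. Then there is a solution $S$ of $\mathcal{K}$ such that (1) $S\cap H\subseteq R$, and (2) $p(S)\ge(1-3\varepsilon)\,\mathrm{OPT}(\mathcal{K})$, where $H=\{\ell\in E : p(\ell)>\varepsilon\cdot\mathrm{OPT}(\mathcal{K})\}$.
   Context: A BMI instance is $\mathcal{K}=(E,\mathcal{I},c,p,\beta)$ with $E$ a finite ground set, $(E,\mathcal{I})$ a matroid, $\beta>0$, $c:E\to[0,\beta]$, $p:E\to\mathbb{R}_{\ge0}$; a solution is $X\in\mathcal{I}$ with $c(X)\le\beta$, where $c(X)=\sum_{e\in X}c(e)$ and similarly for $p$; $\mathrm{OPT}(\mathcal{K})$ is the maximum profit of a solution. Standing assumption: $\{e\}\in\mathcal{I}$ for all $e\in E$. Let $H=\{\ell\in E: p(\ell)>\varepsilon\,\mathrm{OPT}(\mathcal{K})\}$ (profitable elements), $q(\varepsilon)=\varepsilon^{ -\varepsilon^{ -1}}$, and $\mathcal{I}_{\le q(\varepsilon)}=\{A\in\mathcal{I}: |A|\le q(\varepsilon)\}$. For $G\in\mathcal{I}_{\le q(\varepsilon)}$, a set $Z_G\subseteq E$ is a replacement of $G$ (for $\mathcal{K},\varepsilon$) if: (i) $(G\setminus H)\cup Z_G\in\mathcal{I}_{\le q(\varepsilon)}$; (ii) $c(Z_G)\le c(G\cap H)$; (iii) $p((G\setminus H)\cup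 Z_G)\ge(1-\varepsilon)p(G)$; (iv) $|Z_G|\le|G\cap H|$. A set $R\subseteq E$ is a representative set of $\mathcal{K}$ and $\varepsilon$ if every $G\in\mathcal{I}_{\le q(\varepsilon)}$ has a replacement $Z_G\subseteq R$.
   Formalization: The costs c, profits p, budget β and the parameter ε are rational rather than real. -}

module Defs where

open import Data.Nat as ℕ using (ℕ; zero; suc; _^_)
open import Data.Bool using (true; false)
open import Data.Fin using (Fin)
import Data.Fin as F
open import Data.Vec using ([]; _∷_; tabulate)
open import Data.Fin.Subset using (Subset; ⊥; ⁅_⁆; _∈_; _∉_; _⊆_; _∩_; _∪_; _─_; ∣_∣)
open import Data.Integer as ℤ using (+_)
open import Data.Rational using (ℚ; 0ℚ; 1ℚ; _+_; _*_; _-_; _≤_; _<_; ↥_; ↧ₙ_)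
open import Data.Rational.Properties using (_<?_)
open import Data.Product using (_×_; Σ; ∃-syntax)
open import Relation.Binary.PropositionalEquality using (_≡_)
open import Relation.Nullary.Decidable using (does)

sumOver : ∀ {n} → Subset n → (Fin n → ℚ) → ℚ
sumOver {zero}  []          f = 0ℚ
sumOver {suc n} (true  ∷ X) f = f F.zero + sumOver X (λ i → f (F.suc i))
sumOver {suc n} (false ∷ X) f = sumOver X (λ i → f (F.suc i))

-- A BMI instance on the ground set E = Fin n: a matroid (E, Indep)
-- (independence axioms), in which every singleton is independent
-- (standing assumption), costs c : E → [0, β], profits p : E → ℚ≥0, β > 0.
record BMI (n : ℕ) : Set₁ where
  field
    Indep        : Subset n → Set
    indep-∅      : Indep ⊥
    indep-⊆      : ∀ {A B} → A ⊆ B → Indep B → Indep A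
    indep-exch   : ∀ {A B} → Indep A → Indep B → ∣ A ∣ ℕ.< ∣ B ∣ →
                   ∃[ e ] (e ∈ B × e ∉ A × Indep (A ∪ ⁅ e ⁆))
    indep-single : ∀ e → Indep ⁅ e ⁆
    c            : Fin n → ℚ
    p            : Fin n → ℚ
    β            : ℚ
    β-pos        : 0ℚ < β
    c-nonneg     : ∀ e → 0ℚ ≤ c e
    c-le-β       : ∀ e → c e ≤ β
    p-nonneg     : ∀ e → 0ℚ ≤ p e

module _ {n : ℕ} (K : BMI n) where
  open BMI K

  cost : Subset n → ℚ
  cost X = sumOver X c

  profit : Subset n → ℚ
  profit X = sumOver X p

  IsSolution : Subset n → Set
  IsSolution X = Indep X × cost X ≤ β

  IsOPT : ℚ → Set
  IsOPT v = (∃[ X ] (IsSolution X × profit X ≡ v)) ×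
            (∀ X → IsSolution X → profit X ≤ v)

  Profitable : (ε opt : ℚ) → Subset n
  Profitable ε opt = tabulate (λ ℓ → does ((ε * opt) <? p ℓ))

-- k ≤ q(ε) = ε^(-1/ε) for rational ε = a/b > 0 (a, b positive naturals):
-- k ≤ (b/a)^(b/a)  ⇔  k^a ≤ (b/a)^b  ⇔  k^a · a^b ≤ b^b.
AtMostQ : ℚ → ℕ → Set
AtMostQ ε k = (k ^ a) ℕ.* (a ^ b) ℕ.≤ (b ^ b)
  where
  a = ℤ.∣ ↥ ε ∣
  b = ↧ₙ ε

module _ {n : ℕ} (K : BMI n) where
  open BMI K

  InIq : ℚ → Subset n → Set
  InIq ε A = Indep A × AtMostQ ε ∣ A ∣

  IsReplacement : (ε opt : ℚ) → Subset n → Subset n → Set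
  IsReplacement ε opt G Z =
    InIq ε ((G ─ H) ∪ Z) ×
    cost K Z ≤ cost K (G ∩ H) ×
    (1ℚ - ε) * profit K G ≤ profit K ((G ─ H) ∪ Z) ×
    ∣ Z ∣ ℕ.≤ ∣ G ∩ H ∣
    where H = Profitable K ε opt

  IsRepresentative : (ε opt : ℚ) → Subset n → Set
  IsRepresentative ε opt R =
    ∀ G → InIq ε G → ∃[ Z ] (Z ⊆ R × IsReplacement ε opt G Z)

{-# OPTIONS --safe #-}
module Submission where

-- Let S be an optimal solution, G ⊆ S its elements of profit above ε²·OPT and W = S ∖ G the light
-- rest. Since p(G) ≤ OPT, G has at most ε⁻² ≤ q(ε) elements, so it has a replacement Z ⊆ R and
-- A = (G ∖ H) ∪ Z is independent. Augmenting A from the independent set T = (G ∖ H) ∪ W ⊆ S gives an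
-- independent F with A ⊆ F ⊆ A ∪ W and |F| ≥ |T|. Then F ∩ H ⊆ Z ⊆ R, and c(F) ≤ c(S) ≤ β because
-- c(Z) ≤ c(G ∩ H). For every weight w, w(F) + w(W ∖ F) + w(A ∩ W) = w(A) + w(W); with w = 1 and
-- |F| ≥ |G ∖ H| + |W| this gives |W ∖ F| + |A ∩ W| ≤ |Z| ≤ |G ∩ H| ≤ ε⁻¹, and all these elements
-- are light, so with w = p we get p(F) ≥ (1 − ε)·p(G) + p(W) − ε·OPT ≥ (1 − 2ε)·OPT.
-- If OPT = 0, the empty set already works.

open import Defs
open import Algebra.Bundles using (CommutativeMonoid)
open import Data.Nat as ℕ using (ℕ; zero; suc)
import Data.Nat.Properties as ℕ
open import Data.Bool using (true; false)
open import Data.Empty using (⊥-elim)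
open import Data.Fin using (Fin; zero; suc)
open import Data.Vec using ([]; _∷_; here; there)
open import Data.Vec.Properties using ([]=⇒lookup; lookup⇒[]=; lookup∘tabulate)
open import Data.Fin.Subset using (Subset; ⊥; ⁅_⁆; _∈_; _∉_; _⊆_; _∩_; _∪_; _─_; ∣_∣; Empty)
open import Data.Fin.Subset.Properties
  using ( ⊆-antisym; ⊆-trans; drop-∷-⊆; p⊆p∪q; q⊆p∪q; x∈p∪q⁻; p∩q⊆p; p∩q⊆q; x∈p∩q⁻
        ; p─q⊆p; x∈p∧x∉q⇒x∈p─q; ∪-identityʳ; ∩-comm; x∈⁅y⁆⇒x≡y; Empty-unique; ∉⊥)
open import Data.Integer as ℤ using (+_; -[1+_])
import Data.Integer.Properties as ℤ
import Data.Sign.Properties as Sign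
open import Data.Product using (_×_; _,_; ∃-syntax)
open import Data.Sum using (inj₁; inj₂; [_,_]′)
open import Function using (_∘_)
open import Relation.Binary.PropositionalEquality
open import Relation.Nullary using (yes; no; does)

module _ where
  open import Data.Nat
  open import Data.Nat.Properties
  open import Algebra.Properties.CommutativeSemigroup *-commutativeSemigroup using (interchange)

  ^-distribʳ-* : ∀ m n k → (m * n) ^ k ≡ m ^ k * n ^ k
  ^-distribʳ-* m n zero    = refl
  ^-distribʳ-* m n (suc k) = trans (cong ((m * n) *_) (^-distribʳ-* m n k)) (interchange m n (m ^ k) (n ^ k))

  x^[2*a]≡[x*x]^a : ∀ x a → x ^ (2 * a) ≡ (x * x) ^ a
  x^[2*a]≡[x*x]^a x a = trans (sym (^-*-assoc x 2 a)) (cong (λ y → (x * y) ^ a) (*-identityʳ x))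

  -- k ≤ (b/a)² and b/a ≥ 2 give k ≤ (b/a)^(b/a), with denominators cleared.
  k^a*a^b≤b^b : ∀ k a b → 2 * a ≤ b → k * (a * a) ≤ b * b → k ^ a * a ^ b ≤ b ^ b
  k^a*a^b≤b^b k a b 2a≤b ka²≤b² = begin
    k ^ a * a ^ b                 ≡⟨ cong (λ e → k ^ a * a ^ e) 2a+r≡b ⟨
    k ^ a * a ^ (2 * a + r)       ≡⟨ cong (k ^ a *_) (^-distribˡ-+-* a (2 * a) r) ⟩
    k ^ a * (a ^ (2 * a) * a ^ r) ≡⟨ *-assoc (k ^ a) _ _ ⟨
    k ^ a * a ^ (2 * a) * a ^ r   ≡⟨ cong (λ z → k ^ a * z * a ^ r) (x^[2*a]≡[x*x]^a a a) ⟩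
    k ^ a * (a * a) ^ a * a ^ r   ≡⟨ cong (_* a ^ r) (^-distribʳ-* k (a * a) a) ⟨
    (k * (a * a)) ^ a * a ^ r     ≤⟨ *-mono-≤ (^-monoˡ-≤ a ka²≤b²) (^-monoˡ-≤ r a≤b) ⟩
    (b * b) ^ a * b ^ r           ≡⟨ cong (_* b ^ r) (x^[2*a]≡[x*x]^a b a) ⟨
    b ^ (2 * a) * b ^ r           ≡⟨ ^-distribˡ-+-* b (2 * a) r ⟨
    b ^ (2 * a + r)               ≡⟨ cong (b ^_) 2a+r≡b ⟩
    b ^ b                         ∎
    where
    open ≤-Reasoning
    r : ℕ
    r = b ∸ 2 * a
    2a+r≡b : 2 * a + r ≡ b
    2a+r≡b = m+[n∸m]≡n 2a≤b
    a≤b : a ≤ b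
    a≤b = ≤-trans (m≤m+n a (a + 0)) 2a≤b

open import Data.Rational
  using (ℚ; mkℚ; *<*; 0ℚ; 1ℚ; ½; _/_; _+_; _*_; _-_; -_; _≤_; _<_; toℚᵘ; ↥_; ↧ₙ_; nonNegative; positive)
import Data.Rational.Properties as ℚ
open import Data.Rational.Properties using (_<?_)
open import Data.Rational.Unnormalised as ℚᵘ using (mkℚᵘ; _≃_)
import Data.Rational.Unnormalised.Properties as ℚᵘ
open import Data.Rational.Solver using (module +-*-Solver)
open import Algebra.Properties.CommutativeSemigroup
  (CommutativeMonoid.commutativeSemigroup ℚ.+-0-commutativeMonoid)
  using (interchange; x∙yz≈y∙xz; xy∙z≈xz∙y)

private variable
  n : ℕ
  X Y Z : Subset n
  f g : Fin n → ℚ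

0≤p*q : ∀ {p q} → 0ℚ ≤ p → 0ℚ ≤ q → 0ℚ ≤ p * q
0≤p*q {p} 0≤p 0≤q = subst (_≤ p * _) (ℚ.*-zeroʳ p) (ℚ.*-monoˡ-≤-nonNeg p {{nonNegative 0≤p}} 0≤q)

p≤p+q : ∀ {p q} → 0ℚ ≤ q → p ≤ p + q
p≤p+q {p} {q} 0≤q = subst (_≤ p + q) (ℚ.+-identityʳ p) (ℚ.+-monoʳ-≤ p 0≤q)

p≤q+p : ∀ {p q} → 0ℚ ≤ q → p ≤ q + p
p≤q+p {p} {q} 0≤q = subst (_≤ q + p) (ℚ.+-identityˡ p) (ℚ.+-monoˡ-≤ p 0≤q)

p≤q⇒0≤q-p : ∀ {p q} → p ≤ q → 0ℚ ≤ q - p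
p≤q⇒0≤q-p {p} {q} p≤q = subst (_≤ q - p) (ℚ.+-inverseʳ p) (ℚ.+-monoˡ-≤ (- p) p≤q)

0≤q-p⇒p≤q : ∀ {p q} → 0ℚ ≤ q - p → p ≤ q
0≤q-p⇒p≤q {p} {q} 0≤q-p =
  subst₂ _≤_ (ℚ.+-identityˡ p) (solve 2 (λ p q → (q :- p) :+ p := q) refl p q) (ℚ.+-monoˡ-≤ p 0≤q-p)
  where open +-*-Solver

+-cancelˡ-≤ : ∀ r {p q} → r + p ≤ r + q → p ≤ q
+-cancelˡ-≤ r {p} {q} r+p≤r+q =
  0≤q-p⇒p≤q (subst (0ℚ ≤_) (solve 3 (λ r p q → (r :+ q) :- (r :+ p) := q :- p) refl r p q) (p≤q⇒0≤q-p r+p≤r+q))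
  where open +-*-Solver

fromℕ : ℕ → ℚ
fromℕ zero    = 0ℚ
fromℕ (suc k) = 1ℚ + fromℕ k

fromℕ-mono-≤ : ∀ {k m} → k ℕ.≤ m → fromℕ k ≤ fromℕ m
fromℕ-mono-≤ {zero}  {zero}  _ = ℚ.≤-refl
fromℕ-mono-≤ {zero}  {suc m} _ = ℚ.+-mono-≤ (ℚ.≤ᵇ⇒≤ {0ℚ} {1ℚ} _) (fromℕ-mono-≤ {zero} {m} ℕ.z≤n)
fromℕ-mono-≤ {suc k} {suc m} (ℕ.s≤s k≤m) = ℚ.+-monoʳ-≤ 1ℚ (fromℕ-mono-≤ k≤m)

toℚᵘ-fromℕ : ∀ k → toℚᵘ (fromℕ k) ≃ mkℚᵘ (+ k) 0
toℚᵘ-fromℕ zero    = ℚᵘ.≃-refl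
toℚᵘ-fromℕ (suc k) = ℚᵘ.≃-trans (ℚ.toℚᵘ-homo-+ 1ℚ (fromℕ k))
  (ℚᵘ.≃-trans (ℚᵘ.+-congʳ (mkℚᵘ (+ 1) 0) (toℚᵘ-fromℕ k))
              (ℚᵘ.*≡* (cong (λ i → (+ 1 ℤ.+ i) ℤ.* + 1) (ℤ.*-identityʳ (+ k)))))

i*i≡+∣i∣*∣i∣ : ∀ i → i ℤ.* i ≡ + (ℤ.∣ i ∣ ℕ.* ℤ.∣ i ∣)
i*i≡+∣i∣*∣i∣ i rewrite Sign.s*s≡+ (ℤ.sign i) = ℤ.+◃n≡+n _

-- Products in ℚ are normalised, so the inequality is read off from its image in ℚᵘ.
k∣↥ε∣²≤↧ε² : ∀ k ε → fromℕ k * (ε * ε) ≤ 1ℚ → k ℕ.* (ℤ.∣ ↥ ε ∣ ℕ.* ℤ.∣ ↥ ε ∣) ℕ.≤ ↧ₙ ε ℕ.* ↧ₙ ε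
k∣↥ε∣²≤↧ε² k ε@record{} kε²≤1 with ℚᵘ.≤-respˡ-≃ toℚᵘ-kε² (ℚ.toℚᵘ-mono-≤ kε²≤1)
  where
  toℚᵘ-kε² : toℚᵘ (fromℕ k * (ε * ε)) ≃ mkℚᵘ (+ k) 0 ℚᵘ.* (toℚᵘ ε ℚᵘ.* toℚᵘ ε)
  toℚᵘ-kε² = ℚᵘ.≃-trans (ℚ.toℚᵘ-homo-* (fromℕ k) (ε * ε))
                        (ℚᵘ.*-cong (toℚᵘ-fromℕ k) (ℚ.toℚᵘ-homo-* ε ε))
... | ℚᵘ.*≤* le = ℤ.drop‿+≤+ (subst₂ ℤ._≤_ lhs rhs le)
  where
  a b : ℕ
  a = ℤ.∣ ↥ ε ∣
  b = ↧ₙ ε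
  lhs : (+ k ℤ.* (↥ ε ℤ.* ↥ ε)) ℤ.* + 1 ≡ + (k ℕ.* (a ℕ.* a))
  lhs = trans (ℤ.*-identityʳ _) (trans (cong (+ k ℤ.*_) (i*i≡+∣i∣*∣i∣ (↥ ε))) (ℤ.+◃n≡+n _))
  rhs : + 1 ℤ.* + (1 ℕ.* (b ℕ.* b)) ≡ + (b ℕ.* b)
  rhs = trans (ℤ.*-identityˡ _) (cong +_ (ℕ.*-identityˡ _))

2∣↥ε∣≤↧ε : ∀ {ε} → 0ℚ < ε → ε < ½ → 2 ℕ.* ℤ.∣ ↥ ε ∣ ℕ.≤ ↧ₙ ε
2∣↥ε∣≤↧ε {mkℚ -[1+ _ ] _   _} (*<* ()) _
2∣↥ε∣≤↧ε {mkℚ (+ a)    d-1 _} _ (*<* a*2<1*d) =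
  ℕ.<⇒≤ (subst (ℕ._< suc d-1) (ℕ.*-comm a 2) (ℤ.drop‿+<+ a*2<d))
  where
  a*2<d : + (a ℕ.* 2) ℤ.< + suc d-1
  a*2<d = subst₂ ℤ._<_ (ℤ.+◃n≡+n (a ℕ.* 2)) (ℤ.*-identityˡ (+ suc d-1)) a*2<1*d

k*ε²≤1⇒AtMostQ : ∀ k {ε} → 0ℚ < ε → ε < ½ → fromℕ k * (ε * ε) ≤ 1ℚ → AtMostQ ε k
k*ε²≤1⇒AtMostQ k {ε} 0<ε ε<½ kε²≤1 =
  k^a*a^b≤b^b k (ℤ.∣ ↥ ε ∣) (↧ₙ ε) (2∣↥ε∣≤↧ε 0<ε ε<½) (k∣↥ε∣²≤↧ε² k ε kε²≤1)

∣_∣ℚ : Subset n → ℚ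
∣ X ∣ℚ = sumOver X (λ _ → 1ℚ)

∣∣ℚ≡fromℕ∣∣ : ∀ (X : Subset n) → ∣ X ∣ℚ ≡ fromℕ ∣ X ∣
∣∣ℚ≡fromℕ∣∣ []          = refl
∣∣ℚ≡fromℕ∣∣ (true  ∷ X) = cong (_+_ 1ℚ) (∣∣ℚ≡fromℕ∣∣ X)
∣∣ℚ≡fromℕ∣∣ (false ∷ X) = ∣∣ℚ≡fromℕ∣∣ X

∣∣ℚ-mono-≤ : ∀ (X Y : Subset n) → ∣ X ∣ ℕ.≤ ∣ Y ∣ → ∣ X ∣ℚ ≤ ∣ Y ∣ℚ
∣∣ℚ-mono-≤ X Y ∣X∣≤∣Y∣ =
  subst₂ _≤_ (sym (∣∣ℚ≡fromℕ∣∣ X)) (sym (∣∣ℚ≡fromℕ∣∣ Y)) (fromℕ-mono-≤ ∣X∣≤∣Y∣)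

sumOver-⊥ : ∀ n (f : Fin n → ℚ) → sumOver ⊥ f ≡ 0ℚ
sumOver-⊥ zero    f = refl
sumOver-⊥ (suc n) f = sumOver-⊥ n _

sumOver-const : ∀ (X : Subset n) k → sumOver X (λ _ → k) ≡ k * ∣ X ∣ℚ
sumOver-const []          k = sym (ℚ.*-zeroʳ k)
sumOver-const (true  ∷ X) k = begin
  k + sumOver X (λ _ → k) ≡⟨ cong₂ _+_ (ℚ.*-identityʳ k) (sym (sumOver-const X k)) ⟨
  k * 1ℚ + k * ∣ X ∣ℚ     ≡⟨ ℚ.*-distribˡ-+ k 1ℚ ∣ X ∣ℚ ⟨
  k * (1ℚ + ∣ X ∣ℚ)       ∎
  where open ≡-Reasoning
sumOver-const (false ∷ X) k = sumOver-const X k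

sumOver-nonneg : ∀ (X : Subset n) → (∀ i → 0ℚ ≤ f i) → 0ℚ ≤ sumOver X f
sumOver-nonneg []          0≤f = ℚ.≤-refl
sumOver-nonneg (true  ∷ X) 0≤f = ℚ.+-mono-≤ (0≤f zero) (sumOver-nonneg X (0≤f ∘ suc))
sumOver-nonneg (false ∷ X) 0≤f = sumOver-nonneg X (0≤f ∘ suc)

sumOver-mono : ∀ (X : Subset n) → (∀ {i} → i ∈ X → f i ≤ g i) → sumOver X f ≤ sumOver X g
sumOver-mono []          f≤g = ℚ.≤-refl
sumOver-mono (true  ∷ X) f≤g = ℚ.+-mono-≤ (f≤g here) (sumOver-mono X (f≤g ∘ there))
sumOver-mono (false ∷ X) f≤g = sumOver-mono X (f≤g ∘ there)

sumOver-mono-⊆ : (∀ i → 0ℚ ≤ f i) → X ⊆ Y → sumOver X f ≤ sumOver Y f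
sumOver-mono-⊆ {X = []}        {Y = []}        0≤f X⊆Y = ℚ.≤-refl
sumOver-mono-⊆ {X = true ∷ X}  {Y = false ∷ Y} 0≤f X⊆Y with X⊆Y here
... | ()
sumOver-mono-⊆ {f = f} {X = true ∷ X} {Y = true ∷ Y} 0≤f X⊆Y =
  ℚ.+-monoʳ-≤ (f zero) (sumOver-mono-⊆ (0≤f ∘ suc) (drop-∷-⊆ X⊆Y))
sumOver-mono-⊆ {X = false ∷ X} {Y = true ∷ Y}  0≤f X⊆Y =
  ℚ.≤-trans (sumOver-mono-⊆ (0≤f ∘ suc) (drop-∷-⊆ X⊆Y)) (p≤q+p (0≤f zero))
sumOver-mono-⊆ {X = false ∷ X} {Y = false ∷ Y} 0≤f X⊆Y = sumOver-mono-⊆ (0≤f ∘ suc) (drop-∷-⊆ X⊆Y)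

sumOver-∩-─ : ∀ (X Y : Subset n) f → sumOver (X ∩ Y) f + sumOver (X ─ Y) f ≡ sumOver X f
sumOver-∩-─ []          []          f = ℚ.+-identityˡ 0ℚ
sumOver-∩-─ (true  ∷ X) (true  ∷ Y) f =
  trans (ℚ.+-assoc (f zero) (sumOver (X ∩ Y) (f ∘ suc)) _)
        (cong (_+_ (f zero)) (sumOver-∩-─ X Y (f ∘ suc)))
sumOver-∩-─ (true  ∷ X) (false ∷ Y) f =
  trans (x∙yz≈y∙xz (sumOver (X ∩ Y) (f ∘ suc)) (f zero) _)
        (cong (_+_ (f zero)) (sumOver-∩-─ X Y (f ∘ suc)))
sumOver-∩-─ (false ∷ X) (true  ∷ Y) f = sumOver-∩-─ X Y (f ∘ suc)
sumOver-∩-─ (false ∷ X) (false ∷ Y) f = sumOver-∩-─ X Y (f ∘ suc)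

sumOver-∪-∩ : ∀ (X Y : Subset n) f →
              sumOver (X ∪ Y) f + sumOver (X ∩ Y) f ≡ sumOver X f + sumOver Y f
sumOver-∪-∩ []      []      f = refl
sumOver-∪-∩ (s ∷ X) (t ∷ Y) f = cons s t (sumOver-∪-∩ X Y (f ∘ suc))
  where
  open ≡-Reasoning
  x u v a b : ℚ
  x = f zero
  u = sumOver (X ∪ Y) (f ∘ suc)
  v = sumOver (X ∩ Y) (f ∘ suc)
  a = sumOver X (f ∘ suc)
  b = sumOver Y (f ∘ suc)
  cons : ∀ s t → u + v ≡ a + b →
         sumOver ((s ∷ X) ∪ (t ∷ Y)) f + sumOver ((s ∷ X) ∩ (t ∷ Y)) f ≡ sumOver (s ∷ X) f + sumOver (t ∷ Y) f
  cons true true u+v≡a+b = begin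
    (x + u) + (x + v) ≡⟨ interchange x u x v ⟩
    (x + x) + (u + v) ≡⟨ cong (_+_ (x + x)) u+v≡a+b ⟩
    (x + x) + (a + b) ≡⟨ interchange x x a b ⟩
    (x + a) + (x + b) ∎
  cons true false u+v≡a+b = begin
    (x + u) + v ≡⟨ ℚ.+-assoc x u v ⟩
    x + (u + v) ≡⟨ cong (_+_ x) u+v≡a+b ⟩
    x + (a + b) ≡⟨ ℚ.+-assoc x a b ⟨
    (x + a) + b ∎
  cons false true u+v≡a+b = begin
    (x + u) + v ≡⟨ ℚ.+-assoc x u v ⟩
    x + (u + v) ≡⟨ cong (_+_ x) u+v≡a+b ⟩
    x + (a + b) ≡⟨ x∙yz≈y∙xz x a b ⟩
    a + (x + b) ∎
  cons false false u+v≡a+b = u+v≡a+b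

sumOver-∪-≤ : (∀ i → 0ℚ ≤ f i) → ∀ (X Y : Subset n) → sumOver (X ∪ Y) f ≤ sumOver X f + sumOver Y f
sumOver-∪-≤ {f = f} 0≤f X Y = begin
  sumOver (X ∪ Y) f                     ≤⟨ p≤p+q (sumOver-nonneg (X ∩ Y) 0≤f) ⟩
  sumOver (X ∪ Y) f + sumOver (X ∩ Y) f ≡⟨ sumOver-∪-∩ X Y f ⟩
  sumOver X f + sumOver Y f             ∎
  where open ℚ.≤-Reasoning

sumOver-∪-disjoint : ∀ (X Y : Subset n) f → Empty (X ∩ Y) → sumOver (X ∪ Y) f ≡ sumOver X f + sumOver Y f
sumOver-∪-disjoint {n} X Y f X∩Y-empty = begin
  sumOver (X ∪ Y) f                     ≡⟨ ℚ.+-identityʳ _ ⟨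
  sumOver (X ∪ Y) f + 0ℚ                ≡⟨ cong (_+_ (sumOver (X ∪ Y) f)) (sumOver-⊥ n f) ⟨
  sumOver (X ∪ Y) f + sumOver ⊥ f       ≡⟨ cong (λ V → sumOver (X ∪ Y) f + sumOver V f) (Empty-unique X∩Y-empty) ⟨
  sumOver (X ∪ Y) f + sumOver (X ∩ Y) f ≡⟨ sumOver-∪-∩ X Y f ⟩
  sumOver X f + sumOver Y f             ∎
  where open ≡-Reasoning

x∈p─q⇒x∉q : ∀ (p q : Subset n) {x} → x ∈ p ─ q → x ∉ q
x∈p─q⇒x∉q (true  ∷ p) (true ∷ q) () here
x∈p─q⇒x∉q (false ∷ p) (true ∷ q) () here
x∈p─q⇒x∉q (_     ∷ p) (_    ∷ q) (there x∈p─q) (there x∈q) = x∈p─q⇒x∉q p q x∈p─q x∈q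

∪-least : X ⊆ Z → Y ⊆ Z → X ∪ Y ⊆ Z
∪-least {X = X} {Y = Y} X⊆Z Y⊆Z x∈X∪Y = [ X⊆Z , Y⊆Z ]′ (x∈p∪q⁻ X Y x∈X∪Y)

─-sandwich : ∀ {A F W : Subset n} → A ⊆ F → F ⊆ A ∪ W → F ─ W ≡ A ─ W
─-sandwich {A = A} {F} {W} A⊆F F⊆A∪W = ⊆-antisym F─W⊆A─W A─W⊆F─W
  where
  F─W⊆A─W : F ─ W ⊆ A ─ W
  F─W⊆A─W x∈F─W with x∈p∪q⁻ A W (F⊆A∪W (p─q⊆p F W x∈F─W))
  ... | inj₁ x∈A = x∈p∧x∉q⇒x∈p─q x∈A (x∈p─q⇒x∉q F W x∈F─W)
  ... | inj₂ x∈W = ⊥-elim (x∈p─q⇒x∉q F W x∈F─W x∈W)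
  A─W⊆F─W : A ─ W ⊆ F ─ W
  A─W⊆F─W x∈A─W = x∈p∧x∉q⇒x∈p─q (A⊆F (p─q⊆p A W x∈A─W)) (x∈p─q⇒x∉q A W x∈A─W)

sumOver-exchange : ∀ {A F W : Subset n} → A ⊆ F → F ⊆ A ∪ W → ∀ f →
                   sumOver F f + (sumOver (W ─ F) f + sumOver (A ∩ W) f) ≡ sumOver A f + sumOver W f
sumOver-exchange {A = A} {F} {W} A⊆F F⊆A∪W f = begin
  sumOver F f + (sumOver (W ─ F) f + sumOver (A ∩ W) f) ≡⟨ cong (_+ (z + u)) (sumOver-∩-─ F W f) ⟨
  (x + y) + (z + u)                                     ≡⟨ solve 4 (λ x y z u → (x :+ y) :+ (z :+ u) := (u :+ y) :+ (x :+ z))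
                                                                   refl x y z u ⟩
  (u + y) + (x + z)                                     ≡⟨ cong₂ _+_ A-split W-split ⟩
  sumOver A f + sumOver W f                             ∎
  where
  open ≡-Reasoning
  open +-*-Solver
  x y z u : ℚ
  x = sumOver (F ∩ W) f
  y = sumOver (F ─ W) f
  z = sumOver (W ─ F) f
  u = sumOver (A ∩ W) f
  A-split : u + y ≡ sumOver A f
  A-split = trans (cong (λ V → u + sumOver V f) (─-sandwich A⊆F F⊆A∪W)) (sumOver-∩-─ A W f)
  W-split : x + z ≡ sumOver W f
  W-split = trans (cong (λ V → sumOver V f + z) (∩-comm F W)) (sumOver-∩-─ W F f)

∣p∪⁅x⁆∣≡1+∣p∣ : ∀ (p : Subset n) x → x ∉ p → ∣ p ∪ ⁅ x ⁆ ∣ ≡ suc ∣ p ∣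
∣p∪⁅x⁆∣≡1+∣p∣ (true  ∷ p) zero    x∉p = ⊥-elim (x∉p here)
∣p∪⁅x⁆∣≡1+∣p∣ (false ∷ p) zero    x∉p = cong (suc ∘ ∣_∣) (∪-identityʳ p)
∣p∪⁅x⁆∣≡1+∣p∣ (true  ∷ p) (suc x) x∉p = cong suc (∣p∪⁅x⁆∣≡1+∣p∣ p x (x∉p ∘ there))
∣p∪⁅x⁆∣≡1+∣p∣ (false ∷ p) (suc x) x∉p = ∣p∪⁅x⁆∣≡1+∣p∣ p x (x∉p ∘ there)

module _ (K : BMI n) where
  open BMI K

  augment : ∀ k {A T} → Indep A → Indep T → ∣ T ∣ ℕ.≤ k ℕ.+ ∣ A ∣ →
            ∃[ F ] (A ⊆ F × F ⊆ A ∪ T × Indep F × ∣ T ∣ ℕ.≤ ∣ F ∣)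
  augment k {A} {T} indA indT ∣T∣≤k+∣A∣ with ∣ T ∣ ℕ.≤? ∣ A ∣
  ... | yes ∣T∣≤∣A∣ = A , (λ x∈A → x∈A) , p⊆p∪q T , indA , ∣T∣≤∣A∣
  augment zero    indA indT ∣T∣≤∣A∣   | no ∣T∣≰∣A∣ = ⊥-elim (∣T∣≰∣A∣ ∣T∣≤∣A∣)
  augment (suc k) {A} {T} indA indT ∣T∣≤k+∣A∣ | no ∣T∣≰∣A∣
    with indep-exch indA indT (ℕ.≰⇒> ∣T∣≰∣A∣)
  ... | e , e∈T , e∉A , indA+e
    with augment k indA+e indT ∣T∣≤k+∣A+e∣
    where
    ∣T∣≤k+∣A+e∣ : ∣ T ∣ ℕ.≤ k ℕ.+ ∣ A ∪ ⁅ e ⁆ ∣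
    ∣T∣≤k+∣A+e∣ rewrite ∣p∪⁅x⁆∣≡1+∣p∣ A e e∉A | ℕ.+-suc k ∣ A ∣ = ∣T∣≤k+∣A∣
  ... | F , A+e⊆F , F⊆A+e∪T , indF , ∣T∣≤∣F∣ =
    F , A+e⊆F ∘ p⊆p∪q ⁅ e ⁆ , ⊆-trans F⊆A+e∪T A+e∪T⊆A∪T , indF , ∣T∣≤∣F∣
    where
    e⊆A∪T : ⁅ e ⁆ ⊆ A ∪ T
    e⊆A∪T x∈⁅e⁆ rewrite x∈⁅y⁆⇒x≡y e x∈⁅e⁆ = q⊆p∪q A T e∈T
    A+e∪T⊆A∪T : (A ∪ ⁅ e ⁆) ∪ T ⊆ A ∪ T
    A+e∪T⊆A∪T = ∪-least (∪-least (p⊆p∪q T) e⊆A∪T) (q⊆p∪q A T)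

module _ (K : BMI n) (ε opt : ℚ) where
  open BMI K

  ∈-Profitable⁻ : ∀ {i} → i ∈ Profitable K ε opt → ε * opt < p i
  ∈-Profitable⁻ {i} i∈H with ε * opt <? p i in eq
  ... | yes εopt<pᵢ = εopt<pᵢ
  ... | no _ with trans (sym (cong does eq)) (trans (sym (lookup∘tabulate _ i)) ([]=⇒lookup i∈H))
  ...   | ()

  ∉-Profitable⁻ : ∀ {i} → i ∉ Profitable K ε opt → p i ≤ ε * opt
  ∉-Profitable⁻ {i} i∉H with ε * opt <? p i in eq
  ... | yes εopt<pᵢ = ⊥-elim (i∉H (lookup⇒[]= i _ (trans (lookup∘tabulate _ i) (cong does eq))))
  ... | no εopt≮pᵢ  = ℚ.≮⇒≥ εopt≮pᵢ

[1-3ε]o≤x : ∀ {ε o g w u x} → 0ℚ ≤ ε → 0ℚ ≤ w → 0ℚ ≤ o → g + w ≡ o →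
            (1ℚ - ε) * g ≤ u → u + w ≤ x + ε * o → (1ℚ - ((+ 3) / 1) * ε) * o ≤ x
[1-3ε]o≤x {ε} {g = g} {w} {u} {x} 0≤ε 0≤w 0≤o refl [1-ε]g≤u u+w≤x+εo =
  0≤q-p⇒p≤q (subst (0ℚ ≤_) slack≡ 0≤slack)
  where
  open +-*-Solver
  0≤slack : 0ℚ ≤ ((x + ε * (g + w)) - (u + w)) + (u - (1ℚ - ε) * g) + ε * w + ε * (g + w)
  0≤slack = ℚ.+-mono-≤ (ℚ.+-mono-≤ (ℚ.+-mono-≤ (p≤q⇒0≤q-p u+w≤x+εo) (p≤q⇒0≤q-p [1-ε]g≤u))
                                   (0≤p*q 0≤ε 0≤w))
                       (0≤p*q 0≤ε 0≤o)
  slack≡ : ((x + ε * (g + w)) - (u + w)) + (u - (1ℚ - ε) * g) + ε * w + ε * (g + w)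
           ≡ x - (1ℚ - ((+ 3) / 1) * ε) * (g + w)
  slack≡ = solve 5 (λ x u g w ε →
             ((x :+ ε :* (g :+ w)) :- (u :+ w)) :+ (u :- (con 1ℚ :- ε) :* g) :+ ε :* w :+ ε :* (g :+ w)
             := x :- (con 1ℚ :- con ((+ 3) / 1) :* ε) :* (g :+ w)) refl x u g w ε

NearOptimalWithin : BMI n → (ε opt : ℚ) → Subset n → Subset n → Set
NearOptimalWithin K ε opt R S =
  IsSolution K S × (S ∩ Profitable K ε opt) ⊆ R × (1ℚ - ((+ 3) / 1) * ε) * opt ≤ profit K S

⊥-nearOptimal : ∀ (K : BMI n) {ε opt R} → opt ≡ 0ℚ → NearOptimalWithin K ε opt R ⊥
⊥-nearOptimal {n} K {ε} refl = (indep-∅ , cost-⊥≤β) , (λ i∈⊥∩H → ⊥-elim (∉⊥ (p∩q⊆p ⊥ _ i∈⊥∩H))) , loss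
  where
  open BMI K
  cost-⊥≤β : cost K ⊥ ≤ β
  cost-⊥≤β = subst (_≤ β) (sym (sumOver-⊥ n c)) (ℚ.<⇒≤ β-pos)
  loss : (1ℚ - ((+ 3) / 1) * ε) * 0ℚ ≤ profit K ⊥
  loss = ℚ.≤-reflexive (trans (ℚ.*-zeroʳ (1ℚ - ((+ 3) / 1) * ε)) (sym (sumOver-⊥ n p)))

module Construction
  (K : BMI n) {ε opt : ℚ} {S : Subset n} (indS : BMI.Indep K S) (cS≤β : cost K S ≤ BMI.β K)
  (pS≡opt : profit K S ≡ opt) (0<ε : 0ℚ < ε) (ε<½ : ε < ½) (0<opt : 0ℚ < opt)
  where
  open BMI K

  H : Subset n
  H = Profitable K ε opt

  Hε² : Subset n
  Hε² = Profitable K (ε * ε) opt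

  G : Subset n
  G = S ∩ Hε²

  W : Subset n
  W = S ─ Hε²

  T : Subset n
  T = (G ─ H) ∪ W

  G⊆S : G ⊆ S
  G⊆S = p∩q⊆p S Hε²

  W⊆S : W ⊆ S
  W⊆S = p─q⊆p S Hε²

  S-split : ∀ f → sumOver G f + sumOver W f ≡ sumOver S f
  S-split = sumOver-∩-─ S Hε²

  ε²opt≤εopt : ε * ε * opt ≤ ε * opt
  ε²opt≤εopt = begin
    ε * ε * opt    ≡⟨ ℚ.*-assoc ε ε opt ⟩
    ε * (ε * opt)  ≤⟨ ℚ.*-monoʳ-≤-nonNeg (ε * opt) {{nonNegative (0≤p*q (ℚ.<⇒≤ 0<ε) (ℚ.<⇒≤ 0<opt))}} ε≤1 ⟩
    1ℚ * (ε * opt) ≡⟨ ℚ.*-identityˡ (ε * opt) ⟩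
    ε * opt        ∎
    where
    open ℚ.≤-Reasoning
    ε≤1 : ε ≤ 1ℚ
    ε≤1 = ℚ.≤-trans (ℚ.<⇒≤ ε<½) (ℚ.≤ᵇ⇒≤ _)

  W-light : ∀ {i} → i ∈ W → p i ≤ ε * ε * opt
  W-light i∈W = ∉-Profitable⁻ K (ε * ε) opt (x∈p─q⇒x∉q S Hε² i∈W)

  ∈W⇒∉H : ∀ {i} → i ∈ W → i ∉ H
  ∈W⇒∉H i∈W i∈H =
    ℚ.<-irrefl refl (ℚ.≤-<-trans (ℚ.≤-trans (W-light i∈W) ε²opt≤εopt) (∈-Profitable⁻ K ε opt i∈H))

  ∣G∣ε²≤1 : fromℕ ∣ G ∣ * (ε * ε) ≤ 1ℚ
  ∣G∣ε²≤1 = ℚ.*-cancelʳ-≤-pos opt {{positive 0<opt}} (begin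
    fromℕ ∣ G ∣ * (ε * ε) * opt   ≡⟨ solve 3 (λ k ε o → k :* (ε :* ε) :* o := ε :* ε :* o :* k)
                                           refl (fromℕ ∣ G ∣) ε opt ⟩
    ε * ε * opt * fromℕ ∣ G ∣     ≡⟨ cong (_*_ (ε * ε * opt)) (∣∣ℚ≡fromℕ∣∣ G) ⟨
    ε * ε * opt * ∣ G ∣ℚ          ≡⟨ sumOver-const G (ε * ε * opt) ⟨
    sumOver G (λ _ → ε * ε * opt) ≤⟨ sumOver-mono G (ℚ.<⇒≤ ∘ ∈-Profitable⁻ K (ε * ε) opt ∘ p∩q⊆q S Hε²) ⟩
    profit K G                    ≤⟨ sumOver-mono-⊆ p-nonneg G⊆S ⟩
    profit K S                    ≡⟨ pS≡opt ⟩
    opt                           ≡⟨ ℚ.*-identityˡ opt ⟨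
    1ℚ * opt                      ∎)
    where
    open ℚ.≤-Reasoning
    open +-*-Solver

  G∈Iq : InIq K ε G
  G∈Iq = indep-⊆ G⊆S indS , k*ε²≤1⇒AtMostQ ∣ G ∣ 0<ε ε<½ ∣G∣ε²≤1

  indT : Indep T
  indT = indep-⊆ (∪-least (⊆-trans (p─q⊆p G H) G⊆S) W⊆S) indS

  module Completion
    {Z : Subset n} (cZ≤cG∩H : cost K Z ≤ cost K (G ∩ H))
    ([1-ε]pG≤pA : (1ℚ - ε) * profit K G ≤ profit K ((G ─ H) ∪ Z)) (∣Z∣≤∣G∩H∣ : ∣ Z ∣ ℕ.≤ ∣ G ∩ H ∣)
    {F : Subset n} (A⊆F : (G ─ H) ∪ Z ⊆ F) (F⊆A∪T : F ⊆ ((G ─ H) ∪ Z) ∪ T) (∣T∣≤∣F∣ : ∣ T ∣ ℕ.≤ ∣ F ∣)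
    where

    A : Subset n
    A = (G ─ H) ∪ Z

    F⊆A∪W : F ⊆ A ∪ W
    F⊆A∪W = ⊆-trans F⊆A∪T (∪-least (p⊆p∪q W) (∪-least (⊆-trans (p⊆p∪q Z) (p⊆p∪q W)) (q⊆p∪q A W)))

    exchange : ∀ f → sumOver F f + (sumOver (W ─ F) f + sumOver (A ∩ W) f) ≡ sumOver A f + sumOver W f
    exchange = sumOver-exchange A⊆F F⊆A∪W

    cost-F : cost K F ≤ β
    cost-F = begin
      cost K F
        ≤⟨ p≤p+q (ℚ.+-mono-≤ (sumOver-nonneg (W ─ F) c-nonneg) (sumOver-nonneg (A ∩ W) c-nonneg)) ⟩
      cost K F + (cost K (W ─ F) + cost K (A ∩ W))
        ≡⟨ exchange c ⟩
      cost K A + cost K W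
        ≤⟨ ℚ.+-monoˡ-≤ (cost K W) (sumOver-∪-≤ c-nonneg (G ─ H) Z) ⟩
      cost K (G ─ H) + cost K Z + cost K W
        ≤⟨ ℚ.+-monoˡ-≤ (cost K W) (ℚ.+-monoʳ-≤ (cost K (G ─ H)) cZ≤cG∩H) ⟩
      cost K (G ─ H) + cost K (G ∩ H) + cost K W
        ≡⟨ cong (_+ cost K W) (trans (ℚ.+-comm (cost K (G ─ H)) (cost K (G ∩ H))) (sumOver-∩-─ G H c)) ⟩
      cost K G + cost K W
        ≡⟨ S-split c ⟩
      cost K S
        ≤⟨ cS≤β ⟩
      β ∎
      where open ℚ.≤-Reasoning

    G─H∩W-empty : Empty ((G ─ H) ∩ W)
    G─H∩W-empty (i , i∈G─H∩W) with x∈p∩q⁻ (G ─ H) W i∈G─H∩W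
    ... | i∈G─H , i∈W = x∈p─q⇒x∉q S Hε² i∈W (p∩q⊆q S Hε² (p─q⊆p G H i∈G─H))

    ∣W─F∣+∣A∩W∣≤∣Z∣ : ∣ W ─ F ∣ℚ + ∣ A ∩ W ∣ℚ ≤ ∣ Z ∣ℚ
    ∣W─F∣+∣A∩W∣≤∣Z∣ = +-cancelˡ-≤ (∣ G ─ H ∣ℚ + ∣ W ∣ℚ) (begin
      ∣ G ─ H ∣ℚ + ∣ W ∣ℚ + N          ≡⟨ cong (_+ N) (sumOver-∪-disjoint (G ─ H) W _ G─H∩W-empty) ⟨
      ∣ T ∣ℚ + N                       ≤⟨ ℚ.+-monoˡ-≤ N (∣∣ℚ-mono-≤ T F ∣T∣≤∣F∣) ⟩
      ∣ F ∣ℚ + N                       ≡⟨ exchange (λ _ → 1ℚ) ⟩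
      ∣ A ∣ℚ + ∣ W ∣ℚ                  ≤⟨ ℚ.+-monoˡ-≤ ∣ W ∣ℚ (sumOver-∪-≤ (λ _ → ℚ.≤ᵇ⇒≤ _) (G ─ H) Z) ⟩
      ∣ G ─ H ∣ℚ + ∣ Z ∣ℚ + ∣ W ∣ℚ     ≡⟨ xy∙z≈xz∙y ∣ G ─ H ∣ℚ ∣ Z ∣ℚ ∣ W ∣ℚ ⟩
      ∣ G ─ H ∣ℚ + ∣ W ∣ℚ + ∣ Z ∣ℚ     ∎)
      where
      open ℚ.≤-Reasoning
      N : ℚ
      N = ∣ W ─ F ∣ℚ + ∣ A ∩ W ∣ℚ

    εopt∣G∩H∣≤opt : ε * opt * ∣ G ∩ H ∣ℚ ≤ opt
    εopt∣G∩H∣≤opt = begin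
      ε * opt * ∣ G ∩ H ∣ℚ            ≡⟨ sumOver-const (G ∩ H) (ε * opt) ⟨
      sumOver (G ∩ H) (λ _ → ε * opt) ≤⟨ sumOver-mono (G ∩ H) (ℚ.<⇒≤ ∘ ∈-Profitable⁻ K ε opt ∘ p∩q⊆q G H) ⟩
      profit K (G ∩ H)                ≤⟨ sumOver-mono-⊆ p-nonneg (⊆-trans (p∩q⊆p G H) G⊆S) ⟩
      profit K S                      ≡⟨ pS≡opt ⟩
      opt                             ∎
      where open ℚ.≤-Reasoning

    light-loss : profit K (W ─ F) + profit K (A ∩ W) ≤ ε * opt
    light-loss = begin
      profit K (W ─ F) + profit K (A ∩ W)
        ≤⟨ ℚ.+-mono-≤ (sumOver-mono (W ─ F) (W-light ∘ p─q⊆p W F))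
                      (sumOver-mono (A ∩ W) (W-light ∘ p∩q⊆q A W)) ⟩
      sumOver (W ─ F) (λ _ → d) + sumOver (A ∩ W) (λ _ → d)
        ≡⟨ cong₂ _+_ (sumOver-const (W ─ F) d) (sumOver-const (A ∩ W) d) ⟩
      d * ∣ W ─ F ∣ℚ + d * ∣ A ∩ W ∣ℚ
        ≡⟨ ℚ.*-distribˡ-+ d _ _ ⟨
      d * (∣ W ─ F ∣ℚ + ∣ A ∩ W ∣ℚ)
        ≤⟨ ℚ.*-monoˡ-≤-nonNeg d {{nonNegative 0≤d}}
             (ℚ.≤-trans ∣W─F∣+∣A∩W∣≤∣Z∣ (∣∣ℚ-mono-≤ Z (G ∩ H) ∣Z∣≤∣G∩H∣)) ⟩
      d * ∣ G ∩ H ∣ℚ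
        ≡⟨ solve 3 (λ ε o m → ε :* ε :* o :* m := ε :* (ε :* o :* m)) refl ε opt ∣ G ∩ H ∣ℚ ⟩
      ε * (ε * opt * ∣ G ∩ H ∣ℚ)
        ≤⟨ ℚ.*-monoˡ-≤-nonNeg ε {{nonNegative (ℚ.<⇒≤ 0<ε)}} εopt∣G∩H∣≤opt ⟩
      ε * opt
        ∎
      where
      open ℚ.≤-Reasoning
      open +-*-Solver
      d : ℚ
      d = ε * ε * opt
      0≤d : 0ℚ ≤ d
      0≤d = 0≤p*q (0≤p*q (ℚ.<⇒≤ 0<ε) (ℚ.<⇒≤ 0<ε)) (ℚ.<⇒≤ 0<opt)

    profit-F : (1ℚ - ((+ 3) / 1) * ε) * opt ≤ profit K F
    profit-F = [1-3ε]o≤x (ℚ.<⇒≤ 0<ε) (sumOver-nonneg W p-nonneg) (ℚ.<⇒≤ 0<opt) (trans (S-split p) pS≡opt)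
                         [1-ε]pG≤pA (begin
      profit K A + profit K W                            ≡⟨ exchange p ⟨
      profit K F + (profit K (W ─ F) + profit K (A ∩ W)) ≤⟨ ℚ.+-monoʳ-≤ (profit K F) light-loss ⟩
      profit K F + ε * opt                               ∎)
      where open ℚ.≤-Reasoning

    F∩H⊆Z : F ∩ H ⊆ Z
    F∩H⊆Z i∈F∩H with x∈p∩q⁻ F H i∈F∩H
    ... | i∈F , i∈H with x∈p∪q⁻ A W (F⊆A∪W i∈F)
    ...   | inj₂ i∈W = ⊥-elim (∈W⇒∉H i∈W i∈H)
    ...   | inj₁ i∈A with x∈p∪q⁻ (G ─ H) Z i∈A
    ...     | inj₁ i∈G─H = ⊥-elim (x∈p─q⇒x∉q G H i∈G─H i∈H)
    ...     | inj₂ i∈Z   = i∈Z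

  nearOptimal : ∀ {R} → IsRepresentative K ε opt R → ∃[ F ] NearOptimalWithin K ε opt R F
  nearOptimal R-rep =
    let Z , Z⊆R , (indA , _) , cZ≤cG∩H , [1-ε]pG≤pA , ∣Z∣≤∣G∩H∣ = R-rep G G∈Iq
        F , A⊆F , F⊆A∪T , indF , ∣T∣≤∣F∣ = augment K ∣ T ∣ indA indT (ℕ.m≤m+n ∣ T ∣ ∣ (G ─ H) ∪ Z ∣)
        open Completion cZ≤cG∩H [1-ε]pG≤pA ∣Z∣≤∣G∩H∣ A⊆F F⊆A∪T ∣T∣≤∣F∣
    in F , (indF , cost-F) , ⊆-trans F∩H⊆Z Z⊆R , profit-F

lemma3p3 : ∀ {n : ℕ} (K : BMI n) (ε opt : ℚ) (R : Subset n) →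
    IsOPT K opt → 0ℚ < ε → ε < ½ → IsRepresentative K ε opt R →
    ∃[ S ] (IsSolution K S ×
            (S ∩ Profitable K ε opt) ⊆ R ×
            (1ℚ - ((+ 3) / 1) * ε) * opt ≤ profit K S)
lemma3p3 K ε opt R ((S , (indS , cS≤β) , pS≡opt) , _) 0<ε ε<½ R-rep with opt ℚ.≤? 0ℚ
... | yes opt≤0 = ⊥ , ⊥-nearOptimal K {ε} {R = R} (ℚ.≤-antisym opt≤0 0≤opt)
  where
  0≤opt : 0ℚ ≤ opt
  0≤opt = subst (0ℚ ≤_) pS≡opt (sumOver-nonneg S (BMI.p-nonneg K))
... | no opt≰0  = Construction.nearOptimal K indS cS≤β pS≡opt 0<ε ε<½ (ℚ.≰⇒> opt≰0) R-rep
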